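{- Let $S$ be an AMAS and let $\pi=g_0e_0g_1e_1\dots$ be a path in $\mathrm{IIS}^{\epsilon}(S)$ such that, for some $i$, $e_j=\epsilon$ for all $j\ge i$. Then for every coalition $A$, every joint strategy $\sigma_A$ in $S$ and every state $g$, $\pi\notin out^{CF}_{\mathrm{IIS}^{\epsilon}(S)}(g,\sigma_A)$.
   Context: An AMAS $S$ consists of agents $\mathbb{A}\mathrm{gt}=\{1,\dots,n\}$; each agent $i$ has a finite set of local states $L_i$, an initial state $\iota_i$, a finite set of events $\Sigma_i$, a repertoire $R_i:L_i\to 2^{\Sigma_i}\setminus\{\emptyset\}$, and a partial local transition function $T_i:L_i\times\Sigma_i\rightharpoonup L_i$ defined iff $e\in R_i(l)$. $Agent(e)=\{i\mid e\in\Sigma_i\}$. The model $\mathrm{IIS}(S)$ has global states reachable from $(\iota_1,\dots,\iota_n)$ via $T(g,e)=g'$ iff $T_i(g^i,e)=g'^i$ for $i\in Agent(e)$ and $g'^i=g^i$ otherwise; $enabled(g)$ is the set of $e$ with $T(g,e)$ defined; $T$ is assumed serial. A strategy of agent $i$ is $\sigma_i:L_i\to\Sigma_i$ with $\sigma_i(l)\in R_i(l)$; $\sigma_A(g)=(\sigma_i(g^i))_{i\in A}$. For choices $\vec e_A$, $e_i\in R_i(g^i)$, $enabled_{\mathrm{IIS}(S)}(g,\vec e_A)$ is the set of $b\in enabled(g)$ with $b=e_i$ for all $i\in Agent(b)\cap A$ and $b\in R_i(g^i)$ for all $i\in Agent(b)\setminus A$. The undeadlocked model $\mathrm{IIS}^{\epsilon}(S)$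 adds a fresh event $\epsilon$ with $Agent(\epsilon)=\emptyset$ as a self-loop at every state $g$ where some coalition has a choice tuple $\vec e_A$ with $enabled_{\mathrm{IIS}(S)}(g,\vec e_A)=\emptyset$; for such tuples $enabled_{\mathrm{IIS}^{\epsilon}(S)}(g,\vec e_A)=\{\epsilon\}$, otherwise it equals $enabled_{\mathrm{IIS}(S)}(g,\vec e_A)$; $enabled_{\mathrm{IIS}^{\epsilon}(S)}(g)$ is the set of events labelling transitions out of $g$ (including $\epsilon$ if the loop exists). A path is an infinite sequence $g_0e_0g_1\dots$ with $g_k\xrightarrow{e_k}g_{k+1}$; $out(g,\sigma_A)$ is the set of paths with $g_0=g$ and $e_k\in enabled(g_k,\sigma_A(g_k))$ for all $k$. A path $\pi$ satisfies concurrency-fairness (CF) iff there is no event $e$ and no $n$ such that for all $i\ge n$: $e\in enabled(\pi[i])$ and $Agent(e)\cap Agent(e_i)=\emptyset$ (where $\pi[i]=g_i$). The CF-outcome is $out^{CF}(g,\sigma_A)=out(g,\sigma_A)\cap\{\pi\mid\pi$ starts at $g$ and satisfies CF$\}$. -}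

module Defs where

open import Data.Nat using (ℕ; suc; _≥_)
open import Data.Fin using (Fin)
open import Data.Fin.Subset using (Subset; _∈_; _∉_)
open import Data.Product using (Σ; ∃; _×_; _,_)
open import Relation.Binary.PropositionalEquality using (_≡_)
open import Relation.Nullary using (¬_)

-- The partial local transition T_i(l,e) is defined exactly when e ∈ R_i(l):
-- it takes a proof of e ∈ R_i(l) as argument.

record AMAS : Set₁ where
  field
    n    : ℕ
    nL   : Fin n → ℕ
    m    : ℕ
  L : Fin n → Set
  L i = Fin (nL i)
  Ev : Set
  Ev = Fin m
  field
    ι     : (i : Fin n) → L i
    Σᵢ    : Fin n → Ev → Set
    R     : (i : Fin n) → L i → Ev → Set
    R⊆Σ   : ∀ i l e → R i l e → Σᵢ i e
    R-ne  : ∀ i l → ∃ λ e → R i l e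
    T     : (i : Fin n) (l : L i) (e : Ev) → R i l e → L i

module _ (S : AMAS) where
  open AMAS S

  GState : Set
  GState = (i : Fin n) → L i

  Agent : Ev → Fin n → Set
  Agent e i = Σᵢ i e

  Step : GState → Ev → GState → Set
  Step g e g' =
    (∀ i → Agent e i → Σ (R i (g i) e) λ r → T i (g i) e r ≡ g' i)
    × (∀ i → ¬ Agent e i → g' i ≡ g i)

  ι-g : GState
  ι-g = ι

  data Reachable : GState → Set where
    init : Reachable ι-g
    step : ∀ {g e g'} → Reachable g → Step g e g' → Reachable g'

  enabled : GState → Ev → Set
  enabled g e = ∃ λ g' → Step g e g'

  Serial : Set
  Serial = ∀ g → Reachable g → ∃ λ e → enabled g e

  Choice : Subset n → Set
  Choice A = (i : Fin n) → i ∈ A → Ev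

  ValidChoice : (A : Subset n) → GState → Choice A → Set
  ValidChoice A g c = ∀ i (p : i ∈ A) → R i (g i) (c i p)

  enabledC : (A : Subset n) → GState → Choice A → Ev → Set
  enabledC A g c b =
    enabled g b
    × (∀ i (p : i ∈ A) → Agent b i → b ≡ c i p)
    × (∀ i → Agent b i → i ∉ A → R i (g i) b)

  Deadlock : GState → Set
  Deadlock g = Σ (Subset n) λ A → Σ (Choice A) λ c →
    ValidChoice A g c × (∀ b → ¬ enabledC A g c b)

  data EvE : Set where
    ε  : EvE
    ev : Ev → EvE

  AgentE : EvE → Fin n → Set
  AgentE ε      i = Fin 0   -- Agent(ε) = ∅  (Fin 0 is empty)
  AgentE (ev e) i = Agent e i

  StepE : GState → EvE → GState → Set
  StepE g ε      g' = Deadlock g × (∀ i → g' i ≡ g i)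
  StepE g (ev e) g' = Step g e g'

  enabledE : GState → EvE → Set
  enabledE g e = ∃ λ g' → StepE g e g'

  enabledEC : (A : Subset n) → GState → Choice A → EvE → Set
  enabledEC A g c ε      = ∀ b → ¬ enabledC A g c b
  enabledEC A g c (ev b) = enabledC A g c b

  record Path : Set where
    field
      st    : ℕ → GState
      evs   : ℕ → EvE
      reach : Reachable (st 0)
      steps : ∀ k → StepE (st k) (evs k) (st (suc k))

  Strategy : Fin n → Set
  Strategy i = Σ (L i → Ev) λ σ → ∀ l → R i l (σ l)

  JointStrategy : Subset n → Set
  JointStrategy A = (i : Fin n) → i ∈ A → Strategy i

  applyJ : {A : Subset n} → JointStrategy A → GState → Choice A
  applyJ σA g i p with σA i p
  ... | σ , _ = σ (g i)

  InOut : (g : GState) (A : Subset n) → JointStrategy A → Path → Set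
  InOut g A σA π =
    (∀ i → st 0 i ≡ g i) × (∀ k → enabledEC A (st k) (applyJ σA (st k)) (evs k))
    where open Path π

  Disjoint : (Fin n → Set) → (Fin n → Set) → Set
  Disjoint P Q = ∀ j → ¬ (P j × Q j)

  CF : Path → Set
  CF π = ¬ (Σ EvE λ e → Σ ℕ λ N → ∀ i → i ≥ N →
              enabledE (st i) e × Disjoint (AgentE e) (AgentE (evs i)))
    where open Path π

  InOutCF : (g : GState) (A : Subset n) → JointStrategy A → Path → Set
  InOutCF g A σA π = InOut g A σA π × CF π

{-# OPTIONS --safe #-}
module Submission where

open import Defs
open import Data.Nat using (ℕ; _≥_; suc)
open import Data.Fin using (Fin)
open import Data.Fin.Subset using (Subset)
open import Data.Product using (Σ; _×_; _,_; proj₂)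
open import Relation.Binary.PropositionalEquality using (_≡_; subst)
open import Relation.Nullary using (¬_)

-- Agent(ε) = ∅, so ε is concurrent with every event; on a path that ends in
-- ε-loops, ε stays enabled forever and is never taken by anyone, which CF forbids.

module _ (S : AMAS) where
  open Path

  AgentE-ε-disjoint : (P : Fin (AMAS.n S) → Set) → Disjoint S (AgentE S ε) P
  AgentE-ε-disjoint P j (() , _)

  taken⇒enabledE : (π : Path S) (k : ℕ) → enabledE S (st π k) (evs π k)
  taken⇒enabledE π k = st π (suc k) , steps π k

  eventually-ε⇒¬CF : (π : Path S) → Σ ℕ (λ i → ∀ j → j ≥ i → evs π j ≡ ε) → ¬ CF S π
  eventually-ε⇒¬CF π (N , evs≡ε) cf = cf (ε , N , ε-enabled-and-concurrent)
    where
    ε-enabled-and-concurrent : ∀ j → j ≥ N →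
      enabledE S (st π j) ε × Disjoint S (AgentE S ε) (AgentE S (evs π j))
    ε-enabled-and-concurrent j j≥N =
      subst (enabledE S (st π j)) (evs≡ε j j≥N) (taken⇒enabledE π j)
      , AgentE-ε-disjoint (AgentE S (evs π j))

mainTheorem4 : (S : AMAS) → Serial S → (π : Path S)
    → Σ ℕ (λ i → ∀ j → j ≥ i → Path.evs π j ≡ ε)
    → (A : Subset (AMAS.n S)) (σA : JointStrategy S A) (g : GState S)
    → ¬ InOutCF S g A σA π
mainTheorem4 S _ π eventually-ε A σA g inOutCF =
  eventually-ε⇒¬CF S π eventually-ε (proj₂ inOutCF)
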